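{- For every integer $s\ge 0$, $$f_{\{2s+1,2s+2\}}(n)=(1+o(1))\frac{n}{s+1}\quad\text{as } n\to\infty.$$
   Context: For a set $\mathcal{L}$ of positive integers, $f_{\mathcal{L}}(n)$ denotes the maximum number of vectors in $\{0,1\}^n$ such that the Hamming distance between any two distinct ones lies in $\mathcal{L}$. The Hamming distance between two vectors is the number of coordinates in which they differ. -}

module Defs where

open import Data.Bool using (Bool; true; false; if_then_else_)
open import Data.Nat using (ℕ; zero; suc; _+_; _⊔_)
open import Data.Vec using (Vec; []; _∷_)
open import Data.List using (List; []; _∷_; map; length; filter; _++_; foldr)
open import Data.List.Relation.Unary.AllPairs using (AllPairs; allPairs?)
open import Data.List.Membership.Propositional using (_∈_)
import Data.List.Membership.DecPropositional as DecMem
open import Data.Nat.Properties using (_≟_)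
open import Relation.Nullary using (Dec)

hamming : ∀ {n} → Vec Bool n → Vec Bool n → ℕ
hamming [] [] = 0
hamming (true ∷ xs) (true ∷ ys) = hamming xs ys
hamming (false ∷ xs) (false ∷ ys) = hamming xs ys
hamming (true ∷ xs) (false ∷ ys) = suc (hamming xs ys)
hamming (false ∷ xs) (true ∷ ys) = suc (hamming xs ys)

allVecs : (n : ℕ) → List (Vec Bool n)
allVecs zero = [] ∷ []
allVecs (suc n) = map (false ∷_) (allVecs n) ++ map (true ∷_) (allVecs n)

subsets : ∀ {a} {A : Set a} → List A → List (List A)
subsets [] = [] ∷ []
subsets (x ∷ xs) = subsets xs ++ map (x ∷_) (subsets xs)

IsCode : ∀ {n} → List ℕ → List (Vec Bool n) → Set
IsCode L C = AllPairs (λ u v → hamming u v ∈ L) C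

isCode? : ∀ {n} (L : List ℕ) (C : List (Vec Bool n)) → Dec (IsCode L C)
isCode? L C = allPairs? (λ u v → DecMem._∈?_ _≟_ (hamming u v) L) C

f : List ℕ → ℕ → ℕ
f L n = foldr _⊔_ 0 (map length (filter (isCode? L) (subsets (allVecs n))))

module Submission where

-- A code with distances 2s+1, 2s+2 is first normalised: translating it so that one codeword
-- a becomes 0 and appending one coordinate that raises every weight to 2t (t = s+1) turns the
-- other codewords into vectors of weight 2t whose distances lie between 2t-1 and 2t+1; as
-- distance + 2|u ∩ v| = 4t, every distance is even, hence 2t, and every pairwise intersection
-- has size exactly t.  For such a family F and a fixed A ∈ F, the traces A ∩ B take at most
-- 2^(2t) values, so either |F| is bounded by a constant or more than 2t members share a trace
-- K.  Those members form a sunflower with kernel K, and a member D not containing K would meet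
-- each of their more than 2t pairwise disjoint petals, which is impossible as |D| = 2t; hence
-- K ⊆ D for all D ∈ F, the sets D ─ K are disjoint t-sets, and t|F| ≤ n + 1.  Conversely,
-- ⌊n/t⌋ disjoint blocks of t ones are pairwise at distance 2t.

open import Defs
open import Data.Bool using (Bool; true; false; _xor_)
import Data.Bool as Bool
open import Data.Bool.Properties using (not-involutive; ∧-zeroʳ)
open import Data.Fin.Subset using (Subset; Side; inside; outside; ⊥; ⊤; _∩_; _─_; ∣_∣)
open import Data.Fin.Subset.Properties
  using (∩-comm; ∩-assoc; ∩-idem; ∩-identityˡ; ∣p∩q∣≤∣q∣; ∣p─q∣≤∣p∣; ∣⊥∣≡0; ∣⊤∣≡n)
open import Data.Nat
  using (ℕ; zero; suc; _+_; _*_; _^_; _≤_; _<_; z≤n; s≤s; _≤?_; ∣_-_∣; _/_; _%_)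
open import Data.Nat.Properties
open import Data.Nat.DivMod using (m≡m%n+[m/n]*n; m%n≤n)
open import Data.Nat.Tactic.RingSolver using (solve-∀)
open import Data.Vec using (Vec; []; _∷_; zipWith; head; tail; _++_)
open import Data.Vec.Properties using (∷-injective; ≡-dec)
open import Data.List using (List; []; _∷_; length; map; filter) renaming (_++_ to _++ᴸ_)
open import Data.List.Properties using (length-map; length-++; map-∘; map-id; foldr-preservesᵒ)
open import Data.List.Membership.Propositional using (_∈_)
open import Data.List.Membership.Propositional.Properties
  using (foldr-selective; ∈-map⁺; ∈-map⁻; ∈-filter⁺; ∈-filter⁻; ∈-++⁺ˡ; ∈-++⁺ʳ)
open import Data.List.Relation.Unary.Any as Any using (here; there)
open import Data.List.Relation.Unary.All as All using (All; []; _∷_)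
import Data.List.Relation.Unary.All.Properties as Allₚ
open import Data.List.Relation.Unary.AllPairs as AllPairs using (AllPairs; []; _∷_)
import Data.List.Relation.Unary.AllPairs.Properties as AllPairsₚ
open import Data.List.Relation.Binary.Sublist.Propositional as Sublist
  using (_⊆_; []; _∷_; _∷ʳ_; ⊆-refl; ⊆-trans; from∈)
open import Data.List.Relation.Binary.Sublist.Propositional.Properties
  using (All-resp-⊆; filter-⊆; map⁺; ++⁺; ++⁺ʳ; []⊆-universal)
open import Data.Product using (∃; ∃₂; _×_; _,_; proj₁; proj₂)
open import Data.Sum using (_⊎_; inj₁; inj₂; [_,_])
open import Function using (_∘_)
open import Relation.Binary.Definitions using (Symmetric)
open import Relation.Binary.PropositionalEquality
  using (_≡_; _≢_; refl; sym; trans; cong; cong₂; subst; subst₂; module ≡-Reasoning)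
open import Relation.Nullary using (yes; no; contradiction)

private
  variable
    X : Set
    n k : ℕ

_⊕_ : Subset n → Subset n → Subset n
_⊕_ = zipWith _xor_

∣p∣≡∣p∩q∣+∣p─q∣ : ∀ (p q : Subset n) → ∣ p ∣ ≡ ∣ p ∩ q ∣ + ∣ p ─ q ∣
∣p∣≡∣p∩q∣+∣p─q∣ []            []            = refl
∣p∣≡∣p∩q∣+∣p─q∣ (inside  ∷ p) (inside  ∷ q) = cong suc (∣p∣≡∣p∩q∣+∣p─q∣ p q)
∣p∣≡∣p∩q∣+∣p─q∣ (inside  ∷ p) (outside ∷ q) =
  trans (cong suc (∣p∣≡∣p∩q∣+∣p─q∣ p q)) (sym (+-suc _ _))
∣p∣≡∣p∩q∣+∣p─q∣ (outside ∷ p) (inside  ∷ q) = ∣p∣≡∣p∩q∣+∣p─q∣ p q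
∣p∣≡∣p∩q∣+∣p─q∣ (outside ∷ p) (outside ∷ q) = ∣p∣≡∣p∩q∣+∣p─q∣ p q

∣p++q∣≡∣p∣+∣q∣ : ∀ {m} (p : Subset m) (q : Subset n) → ∣ p ++ q ∣ ≡ ∣ p ∣ + ∣ q ∣
∣p++q∣≡∣p∣+∣q∣ []            q = refl
∣p++q∣≡∣p∣+∣q∣ (inside  ∷ p) q = cong suc (∣p++q∣≡∣p∣+∣q∣ p q)
∣p++q∣≡∣p∣+∣q∣ (outside ∷ p) q = ∣p++q∣≡∣p∣+∣q∣ p q

[p∩q]─r≡p∩[q─r] : ∀ (p q r : Subset n) → (p ∩ q) ─ r ≡ p ∩ (q ─ r)
[p∩q]─r≡p∩[q─r] []      []      []            = refl
[p∩q]─r≡p∩[q─r] (x ∷ p) (y ∷ q) (inside  ∷ r) =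
  cong₂ _∷_ (sym (∧-zeroʳ x)) ([p∩q]─r≡p∩[q─r] p q r)
[p∩q]─r≡p∩[q─r] (x ∷ p) (y ∷ q) (outside ∷ r) = cong (_ ∷_) ([p∩q]─r≡p∩[q─r] p q r)

p∩[q∩p]≡q∩p : ∀ (p q : Subset n) → p ∩ (q ∩ p) ≡ q ∩ p
p∩[q∩p]≡q∩p p q = begin
  p ∩ (q ∩ p) ≡⟨ cong (p ∩_) (∩-comm q p) ⟩
  p ∩ (p ∩ q) ≡⟨ ∩-assoc p p q ⟨
  (p ∩ p) ∩ q ≡⟨ cong (_∩ q) (∩-idem p) ⟩
  p ∩ q       ≡⟨ ∩-comm p q ⟩
  q ∩ p       ∎
  where open ≡-Reasoning

∣p∩q∣≡∣q∣⇒p∩q≡q : ∀ (p q : Subset n) → ∣ p ∩ q ∣ ≡ ∣ q ∣ → p ∩ q ≡ q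
∣p∩q∣≡∣q∣⇒p∩q≡q []            []            _ = refl
∣p∩q∣≡∣q∣⇒p∩q≡q (inside  ∷ p) (inside  ∷ q) e =
  cong (inside ∷_) (∣p∩q∣≡∣q∣⇒p∩q≡q p q (suc-injective e))
∣p∩q∣≡∣q∣⇒p∩q≡q (inside  ∷ p) (outside ∷ q) e = cong (outside ∷_) (∣p∩q∣≡∣q∣⇒p∩q≡q p q e)
∣p∩q∣≡∣q∣⇒p∩q≡q (outside ∷ p) (inside  ∷ q) e =
  contradiction e (<⇒≢ (s≤s (∣p∩q∣≤∣q∣ p q)))
∣p∩q∣≡∣q∣⇒p∩q≡q (outside ∷ p) (outside ∷ q) e = cong (outside ∷_) (∣p∩q∣≡∣q∣⇒p∩q≡q p q e)

∣p∩q∣≡∣p∩r∣+∣p∩[q─r]∣ : ∀ (p q r : Subset n) → q ∩ r ≡ r →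
                        ∣ p ∩ q ∣ ≡ ∣ p ∩ r ∣ + ∣ p ∩ (q ─ r) ∣
∣p∩q∣≡∣p∩r∣+∣p∩[q─r]∣ p q r q∩r≡r = begin
  ∣ p ∩ q ∣                         ≡⟨ ∣p∣≡∣p∩q∣+∣p─q∣ (p ∩ q) r ⟩
  ∣ (p ∩ q) ∩ r ∣ + ∣ (p ∩ q) ─ r ∣ ≡⟨ cong₂ _+_ (cong ∣_∣ p∩q∩r≡p∩r)
                                                (cong ∣_∣ ([p∩q]─r≡p∩[q─r] p q r)) ⟩
  ∣ p ∩ r ∣ + ∣ p ∩ (q ─ r) ∣       ∎
  where
  open ≡-Reasoning
  p∩q∩r≡p∩r : (p ∩ q) ∩ r ≡ p ∩ r
  p∩q∩r≡p∩r = trans (∩-assoc p q r) (cong (p ∩_) q∩r≡r)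

Disjoint : Subset n → Subset n → Set
Disjoint p q = ∣ p ∩ q ∣ ≡ 0

∣[p─q]∩r∣≡∣p∩r∣ : ∀ (p q r : Subset n) → Disjoint q r → ∣ (p ─ q) ∩ r ∣ ≡ ∣ p ∩ r ∣
∣[p─q]∩r∣≡∣p∩r∣ p q r q∩r≡0 = sym (begin
  ∣ p ∩ r ∣                         ≡⟨ ∣p∣≡∣p∩q∣+∣p─q∣ (p ∩ r) q ⟩
  ∣ (p ∩ r) ∩ q ∣ + ∣ (p ∩ r) ─ q ∣ ≡⟨ cong₂ _+_ ∣p∩r∩q∣≡0 (cong ∣_∣ p∩r─q≡[p─q]∩r) ⟩
  ∣ (p ─ q) ∩ r ∣                   ∎)
  where
  open ≡-Reasoning
  ∣p∩r∩q∣≡0 : ∣ (p ∩ r) ∩ q ∣ ≡ 0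
  ∣p∩r∩q∣≡0 = n≤0⇒n≡0 (subst (∣ (p ∩ r) ∩ q ∣ ≤_) (trans (cong ∣_∣ (∩-comm r q)) q∩r≡0)
    (subst (_≤ ∣ r ∩ q ∣) (cong ∣_∣ (sym (∩-assoc p r q))) (∣p∩q∣≤∣q∣ p (r ∩ q))))
  p∩r─q≡[p─q]∩r : (p ∩ r) ─ q ≡ (p ─ q) ∩ r
  p∩r─q≡[p─q]∩r = begin
    (p ∩ r) ─ q ≡⟨ cong (_─ q) (∩-comm p r) ⟩
    (r ∩ p) ─ q ≡⟨ [p∩q]─r≡p∩[q─r] r p q ⟩
    r ∩ (p ─ q) ≡⟨ ∩-comm r (p ─ q) ⟩
    (p ─ q) ∩ r ∎

-- Pigeonholing on restrict a rather than on a ∩ _ gives 2 ^ ∣ a ∣ classes instead of 2 ^ n.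
restrict : (a : Subset n) → Subset n → Subset ∣ a ∣
restrict []            []      = []
restrict (inside  ∷ a) (x ∷ p) = x ∷ restrict a p
restrict (outside ∷ a) (x ∷ p) = restrict a p

restrict-injective : ∀ (a p q : Subset n) → restrict a p ≡ restrict a q → a ∩ p ≡ a ∩ q
restrict-injective []            []      []      _ = refl
restrict-injective (inside  ∷ a) (x ∷ p) (y ∷ q) e =
  cong₂ _∷_ (proj₁ (∷-injective e)) (restrict-injective a p q (proj₂ (∷-injective e)))
restrict-injective (outside ∷ a) (x ∷ p) (y ∷ q) e =
  cong (outside ∷_) (restrict-injective a p q e)

∣p⊕q∣≡hamming : ∀ (p q : Subset n) → ∣ p ⊕ q ∣ ≡ hamming p q
∣p⊕q∣≡hamming []            []            = refl
∣p⊕q∣≡hamming (inside  ∷ p) (inside  ∷ q) = ∣p⊕q∣≡hamming p q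
∣p⊕q∣≡hamming (inside  ∷ p) (outside ∷ q) = cong suc (∣p⊕q∣≡hamming p q)
∣p⊕q∣≡hamming (outside ∷ p) (inside  ∷ q) = cong suc (∣p⊕q∣≡hamming p q)
∣p⊕q∣≡hamming (outside ∷ p) (outside ∷ q) = ∣p⊕q∣≡hamming p q

⊕-cancelˡ : ∀ (a p q : Subset n) → (a ⊕ p) ⊕ (a ⊕ q) ≡ p ⊕ q
⊕-cancelˡ []      []      []      = refl
⊕-cancelˡ (x ∷ a) (y ∷ p) (z ∷ q) = cong₂ _∷_ (xor-cancelˡ x y z) (⊕-cancelˡ a p q)
  where
  xor-cancelˡ : ∀ x y z → (x xor y) xor (x xor z) ≡ y xor z
  xor-cancelˡ false y     z = refl
  xor-cancelˡ true  true  z = refl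
  xor-cancelˡ true  false z = not-involutive z

hamming-⊕ˡ : ∀ (a p q : Subset n) → hamming (a ⊕ p) (a ⊕ q) ≡ hamming p q
hamming-⊕ˡ a p q = begin
  hamming (a ⊕ p) (a ⊕ q) ≡⟨ ∣p⊕q∣≡hamming (a ⊕ p) (a ⊕ q) ⟨
  ∣ (a ⊕ p) ⊕ (a ⊕ q) ∣   ≡⟨ cong ∣_∣ (⊕-cancelˡ a p q) ⟩
  ∣ p ⊕ q ∣               ≡⟨ ∣p⊕q∣≡hamming p q ⟩
  hamming p q             ∎
  where open ≡-Reasoning

hamming+2∣p∩q∣≡∣p∣+∣q∣ : ∀ (p q : Subset n) →
                         hamming p q + (∣ p ∩ q ∣ + ∣ p ∩ q ∣) ≡ ∣ p ∣ + ∣ q ∣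
hamming+2∣p∩q∣≡∣p∣+∣q∣ []            []            = refl
hamming+2∣p∩q∣≡∣p∣+∣q∣ (inside  ∷ p) (inside  ∷ q) = begin
  hamming p q + (suc i + suc i)     ≡⟨ shift (hamming p q) i ⟩
  suc (suc (hamming p q + (i + i))) ≡⟨ cong (suc ∘ suc) (hamming+2∣p∩q∣≡∣p∣+∣q∣ p q) ⟩
  suc (suc (∣ p ∣ + ∣ q ∣))         ≡⟨ cong suc (+-suc ∣ p ∣ ∣ q ∣) ⟨
  suc ∣ p ∣ + suc ∣ q ∣             ∎
  where
  open ≡-Reasoning
  i = ∣ p ∩ q ∣
  shift : ∀ h i → h + (suc i + suc i) ≡ suc (suc (h + (i + i)))
  shift = solve-∀
hamming+2∣p∩q∣≡∣p∣+∣q∣ (inside  ∷ p) (outside ∷ q) = cong suc (hamming+2∣p∩q∣≡∣p∣+∣q∣ p q)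
hamming+2∣p∩q∣≡∣p∣+∣q∣ (outside ∷ p) (inside  ∷ q) =
  trans (cong suc (hamming+2∣p∩q∣≡∣p∣+∣q∣ p q)) (sym (+-suc ∣ p ∣ ∣ q ∣))
hamming+2∣p∩q∣≡∣p∣+∣q∣ (outside ∷ p) (outside ∷ q) = hamming+2∣p∩q∣≡∣p∣+∣q∣ p q

hamming-⊥ʳ : ∀ (p : Subset n) → hamming p ⊥ ≡ ∣ p ∣
hamming-⊥ʳ []            = refl
hamming-⊥ʳ (inside  ∷ p) = cong suc (hamming-⊥ʳ p)
hamming-⊥ʳ (outside ∷ p) = hamming-⊥ʳ p

hamming-⊥ˡ : ∀ (p : Subset n) → hamming ⊥ p ≡ ∣ p ∣
hamming-⊥ˡ []            = refl
hamming-⊥ˡ (inside  ∷ p) = cong suc (hamming-⊥ˡ p)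
hamming-⊥ˡ (outside ∷ p) = hamming-⊥ˡ p

hamming-++ : ∀ {m} (p p′ : Subset m) (q q′ : Subset n) →
             hamming (p ++ q) (p′ ++ q′) ≡ hamming p p′ + hamming q q′
hamming-++ []            []             q q′ = refl
hamming-++ (inside  ∷ p) (inside  ∷ p′) q q′ = hamming-++ p p′ q q′
hamming-++ (inside  ∷ p) (outside ∷ p′) q q′ = cong suc (hamming-++ p p′ q q′)
hamming-++ (outside ∷ p) (inside  ∷ p′) q q′ = cong suc (hamming-++ p p′ q q′)
hamming-++ (outside ∷ p) (outside ∷ p′) q q′ = hamming-++ p p′ q q′

hamming-⊥++ : ∀ r (p q : Subset n) → hamming (⊥ {r} ++ p) (⊥ ++ q) ≡ hamming p q
hamming-⊥++ r p q = trans (hamming-++ (⊥ {r}) ⊥ p q)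
  (cong (_+ hamming p q) (trans (hamming-⊥ʳ (⊥ {r})) (∣⊥∣≡0 r)))

hamming≤hamming-∷ : ∀ x y (p q : Subset n) → hamming p q ≤ hamming (x ∷ p) (y ∷ q)
hamming≤hamming-∷ inside  inside  p q = ≤-refl
hamming≤hamming-∷ inside  outside p q = n≤1+n _
hamming≤hamming-∷ outside inside  p q = n≤1+n _
hamming≤hamming-∷ outside outside p q = ≤-refl

hamming-∷≤suc-hamming : ∀ x y (p q : Subset n) → hamming (x ∷ p) (y ∷ q) ≤ suc (hamming p q)
hamming-∷≤suc-hamming inside  inside  p q = n≤1+n _
hamming-∷≤suc-hamming inside  outside p q = ≤-refl
hamming-∷≤suc-hamming outside inside  p q = ≤-refl
hamming-∷≤suc-hamming outside outside p q = n≤1+n _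

AllPairs-resp-⊆ : ∀ {R : X → X → Set} {xs ys} → xs ⊆ ys → AllPairs R ys → AllPairs R xs
AllPairs-resp-⊆ []             []       = []
AllPairs-resp-⊆ (_ ∷ʳ xs⊆ys)   (_ ∷ rs) = AllPairs-resp-⊆ xs⊆ys rs
AllPairs-resp-⊆ (refl ∷ xs⊆ys) (r ∷ rs) = All-resp-⊆ xs⊆ys r ∷ AllPairs-resp-⊆ xs⊆ys rs

AllPairs-lookup : ∀ {R : X → X → Set} → Symmetric R → ∀ {xs x y} →
                  AllPairs R xs → x ∈ xs → y ∈ xs → x ≢ y → R x y
AllPairs-lookup sym (r ∷ rs) (here refl) (here refl) x≢y = contradiction refl x≢y
AllPairs-lookup sym (r ∷ rs) (here refl) (there y∈)  _   = All.lookup r y∈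
AllPairs-lookup sym (r ∷ rs) (there x∈)  (here refl) _   = sym (All.lookup r x∈)
AllPairs-lookup sym (r ∷ rs) (there x∈)  (there y∈)  x≢y = AllPairs-lookup sym rs x∈ y∈ x≢y

AllPairs-mapWith-All : ∀ {P : X → Set} {R S : X → X → Set} →
                       (∀ {x y} → P x → P y → R x y → S x y) →
                       ∀ {xs} → All P xs → AllPairs R xs → AllPairs S xs
AllPairs-mapWith-All f []       []       = []
AllPairs-mapWith-All f (p ∷ ps) (r ∷ rs) =
  All.zipWith (λ (q , r′) → f p q r′) (ps , r) ∷ AllPairs-mapWith-All f ps rs

length-filter-true+false : (p : X → Bool) (xs : List X) →
  length (filter (λ x → p x Bool.≟ true) xs) + length (filter (λ x → p x Bool.≟ false) xs)
    ≡ length xs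
length-filter-true+false p []       = refl
length-filter-true+false p (x ∷ xs) with p x
... | true  = cong suc (length-filter-true+false p xs)
... | false = trans (+-suc _ _) (cong suc (length-filter-true+false p xs))

majority : (p : X → Bool) (xs : List X) →
           ∃₂ λ b ys → ys ⊆ xs × All (λ x → p x ≡ b) ys × length xs ≤ 2 * length ys
majority p xs = pick (≤-total (length F) (length T))
  where
  T = filter (λ x → p x Bool.≟ true) xs
  F = filter (λ x → p x Bool.≟ false) xs

  a+b≤2a : ∀ {a b} → b ≤ a → a + b ≤ 2 * a
  a+b≤2a {a} b≤a = ≤-trans (+-monoʳ-≤ a b≤a) (≤-reflexive (cong (a +_) (sym (+-identityʳ a))))

  pick : length F ≤ length T ⊎ length T ≤ length F →
         ∃₂ λ b ys → ys ⊆ xs × All (λ x → p x ≡ b) ys × length xs ≤ 2 * length ys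
  pick (inj₁ F≤T) = true , T , filter-⊆ _ xs , Allₚ.all-filter _ xs ,
    subst (_≤ 2 * length T) (length-filter-true+false p xs) (a+b≤2a F≤T)
  pick (inj₂ T≤F) = false , F , filter-⊆ _ xs , Allₚ.all-filter _ xs ,
    subst (_≤ 2 * length F) (trans (+-comm (length F) (length T)) (length-filter-true+false p xs))
          (a+b≤2a T≤F)

pigeonhole : ∀ {m} (g : X → Vec Bool m) (xs : List X) →
             ∃₂ λ v ys → ys ⊆ xs × All (λ x → g x ≡ v) ys × length xs ≤ 2 ^ m * length ys
pigeonhole {m = zero} g xs =
  [] , xs , ⊆-refl , All.tabulate (λ {x} _ → empty (g x)) , ≤-reflexive (sym (+-identityʳ _))
  where
  empty : (v : Vec Bool 0) → v ≡ []
  empty [] = refl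
pigeonhole {m = suc m} g xs with majority (head ∘ g) xs
... | b , ys , ys⊆xs , heads , xs≤2ys with pigeonhole (tail ∘ g) ys
...   | v , zs , zs⊆ys , tails , ys≤2^mzs =
  b ∷ v , zs , ⊆-trans zs⊆ys ys⊆xs ,
  All.zipWith (λ (h , t) → trans (∷-head-tail _) (cong₂ _∷_ h t)) (All-resp-⊆ zs⊆ys heads , tails) ,
  ≤-trans xs≤2ys (≤-trans (*-monoʳ-≤ 2 ys≤2^mzs) (≤-reflexive (sym (*-assoc 2 (2 ^ m) _))))
  where
  ∷-head-tail : (w : Vec Bool (suc m)) → w ≡ head w ∷ tail w
  ∷-head-tail (x ∷ w) = refl

-- Sunflowers

disjoint-count : ∀ c (D : Subset n) (L : List (Subset n)) → AllPairs Disjoint L →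
                 All (λ v → c ≤ ∣ D ∩ v ∣) L → c * length L ≤ ∣ D ∣
disjoint-count c D []      _               _          = ≤-trans (≤-reflexive (*-zeroʳ c)) z≤n
disjoint-count c D (v ∷ L) (v-disj ∷ disj) (c≤ ∷ c≤s) = begin
  c * suc (length L)    ≡⟨ *-suc c (length L) ⟩
  c + c * length L      ≤⟨ +-mono-≤ c≤ (disjoint-count c (D ─ v) L disj c≤s′) ⟩
  ∣ D ∩ v ∣ + ∣ D ─ v ∣ ≡⟨ ∣p∣≡∣p∩q∣+∣p─q∣ D v ⟨
  ∣ D ∣                 ∎
  where
  open ≤-Reasoning
  c≤s′ : All (λ w → c ≤ ∣ (D ─ v) ∩ w ∣) L
  c≤s′ = All.zipWith
    (λ {w} (v∩w≡0 , c≤w) → subst (c ≤_) (sym (∣[p─q]∩r∣≡∣p∩r∣ D v w v∩w≡0)) c≤w) (v-disj , c≤s)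

petals-disjoint : ∀ {B C K : Subset n} → B ∩ K ≡ K → C ∩ K ≡ K → ∣ B ∩ C ∣ ≡ ∣ K ∣ →
                  Disjoint (B ─ K) (C ─ K)
petals-disjoint {B = B} {C} {K} B∩K≡K C∩K≡K ∣B∩C∣≡∣K∣ = n≤0⇒n≡0 (begin
  ∣ (B ─ K) ∩ (C ─ K) ∣ ≡⟨ cong ∣_∣ (∩-comm (B ─ K) (C ─ K)) ⟩
  ∣ (C ─ K) ∩ (B ─ K) ∣ ≡⟨ cong ∣_∣ ([p∩q]─r≡p∩[q─r] (C ─ K) B K) ⟨
  ∣ ((C ─ K) ∩ B) ─ K ∣ ≤⟨ ∣p─q∣≤∣p∣ ((C ─ K) ∩ B) K ⟩
  ∣ (C ─ K) ∩ B ∣       ≡⟨ cong ∣_∣ (∩-comm (C ─ K) B) ⟩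
  ∣ B ∩ (C ─ K) ∣       ≡⟨ +-cancelˡ-≡ ∣ K ∣ _ _ ∣K∣+∣B∩[C─K]∣≡∣K∣+0 ⟩
  0                     ∎)
  where
  open ≤-Reasoning
  ∣K∣+∣B∩[C─K]∣≡∣K∣+0 : ∣ K ∣ + ∣ B ∩ (C ─ K) ∣ ≡ ∣ K ∣ + 0
  ∣K∣+∣B∩[C─K]∣≡∣K∣+0 = trans (cong (λ k → ∣ k ∣ + ∣ B ∩ (C ─ K) ∣) (sym B∩K≡K))
    (trans (sym (∣p∩q∣≡∣p∩r∣+∣p∩[q─r]∣ B C K C∩K≡K)) (trans ∣B∩C∣≡∣K∣ (sym (+-identityʳ _))))

sunflower-kernel : ∀ (K D : Subset n) (S : List (Subset n)) →
  All (λ B → B ∩ K ≡ K) S → AllPairs (λ B C → ∣ B ∩ C ∣ ≡ ∣ K ∣) S →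
  All (λ B → ∣ D ∩ B ∣ ≡ ∣ K ∣) S → ∣ D ∣ < length S → D ∩ K ≡ K
sunflower-kernel K D S kernel pairs meets ∣D∣<∣S∣ with m≤n⇒m<n∨m≡n (∣p∩q∣≤∣q∣ D K)
... | inj₂ ∣D∩K∣≡∣K∣ = ∣p∩q∣≡∣q∣⇒p∩q≡q D K ∣D∩K∣≡∣K∣
... | inj₁ ∣D∩K∣<∣K∣ = contradiction ∣S∣≤∣D∣ (<⇒≱ ∣D∣<∣S∣)
  where
  petal-met : ∀ {B} → B ∩ K ≡ K → ∣ D ∩ B ∣ ≡ ∣ K ∣ → 1 ≤ ∣ D ∩ (B ─ K) ∣
  petal-met {B} B∩K≡K ∣D∩B∣≡∣K∣ = +-cancelˡ-< ∣ D ∩ K ∣ 0 _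
    (subst₂ _<_ (sym (+-identityʳ _))
                (trans (sym ∣D∩B∣≡∣K∣) (∣p∩q∣≡∣p∩r∣+∣p∩[q─r]∣ D B K B∩K≡K)) ∣D∩K∣<∣K∣)
  ∣S∣≤∣D∣ : length S ≤ ∣ D ∣
  ∣S∣≤∣D∣ = subst (_≤ ∣ D ∣) (trans (*-identityˡ _) (length-map (_─ K) S))
    (disjoint-count 1 D (map (_─ K) S)
      (AllPairsₚ.map⁺ (AllPairs-mapWith-All petals-disjoint kernel pairs))
      (Allₚ.map⁺ (All.zipWith (λ (B∩K≡K , ∣D∩B∣≡∣K∣) → petal-met B∩K≡K ∣D∩B∣≡∣K∣)
                              (kernel , meets))))

sunflower-bound : ∀ {N} c (K : Subset N) (F : List (Subset N)) →
  All (λ D → D ∩ K ≡ K) F → All (λ D → ∣ D ∣ ≡ ∣ K ∣ + c) F →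
  AllPairs (λ D E → ∣ D ∩ E ∣ ≡ ∣ K ∣) F → c * length F ≤ N
sunflower-bound {N} c K F kernel weights pairs =
  subst₂ (λ l m → c * l ≤ m) (length-map (_─ K) F) (∣⊤∣≡n N)
    (disjoint-count c ⊤ (map (_─ K) F)
      (AllPairsₚ.map⁺ (AllPairs-mapWith-All petals-disjoint kernel pairs))
      (Allₚ.map⁺ (All.zipWith (λ (D∩K≡K , ∣D∣≡∣K∣+c) → ≤-reflexive (petal-weight D∩K≡K ∣D∣≡∣K∣+c))
                              (kernel , weights))))
  where
  petal-weight : ∀ {D} → D ∩ K ≡ K → ∣ D ∣ ≡ ∣ K ∣ + c → c ≡ ∣ ⊤ ∩ (D ─ K) ∣
  petal-weight {D} D∩K≡K ∣D∣≡∣K∣+c = +-cancelˡ-≡ ∣ K ∣ _ _ (begin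
    ∣ K ∣ + c               ≡⟨ ∣D∣≡∣K∣+c ⟨
    ∣ D ∣                   ≡⟨ ∣p∣≡∣p∩q∣+∣p─q∣ D K ⟩
    ∣ D ∩ K ∣ + ∣ D ─ K ∣   ≡⟨ cong₂ (λ p q → ∣ p ∣ + ∣ q ∣) D∩K≡K (sym (∩-identityˡ (D ─ K))) ⟩
    ∣ K ∣ + ∣ ⊤ ∩ (D ─ K) ∣ ∎)
    where open ≡-Reasoning

large-trace-class⇒kernel : ∀ t (A : Subset n) (R S : List (Subset n)) {v} →
  All (λ D → ∣ D ∣ ≡ t + t) R → All (λ D → ∣ A ∩ D ∣ ≡ t) R →
  AllPairs (λ D E → ∣ D ∩ E ∣ ≡ t) R →
  S ⊆ R → All (λ B → restrict A B ≡ v) S → t + t < length S →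
  ∃ λ K → ∣ K ∣ ≡ t × All (λ D → D ∩ K ≡ K) (A ∷ R)
large-trace-class⇒kernel t A R (B₀ ∷ S) {v} weights A-meets pairs S⊆R same-restriction large =
  K , ∣K∣≡t , A∩K≡K ∷ All.tabulate R-kernel
  where
  K = A ∩ B₀
  ∣K∣≡t = All.lookup A-meets (Sublist.lookup S⊆R (here refl))
  A∩K≡K : A ∩ K ≡ K
  A∩K≡K = trans (sym (∩-assoc A A B₀)) (cong (_∩ B₀) (∩-idem A))

  trace≡K : ∀ {D} → restrict A D ≡ v → A ∩ D ≡ K
  trace≡K {D} same = restrict-injective A D B₀ (trans same (sym (All.head same-restriction)))

  trace⇒kernel : ∀ {D} → A ∩ D ≡ K → D ∩ K ≡ K
  trace⇒kernel {D} A∩D≡K = subst (λ k → D ∩ k ≡ k) A∩D≡K (p∩[q∩p]≡q∩p D A)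

  R-kernel : ∀ {D} → D ∈ R → D ∩ K ≡ K
  R-kernel {D} D∈R with ≡-dec Bool._≟_ (restrict A D) v
  ... | yes same  = trace⇒kernel (trace≡K same)
  ... | no differ = sunflower-kernel K D (B₀ ∷ S)
        (All.map (trace⇒kernel ∘ trace≡K) same-restriction)
        (AllPairs.map (λ ∣B∩C∣≡t → trans ∣B∩C∣≡t (sym ∣K∣≡t)) (AllPairs-resp-⊆ S⊆R pairs))
        (All.tabulate (λ B∈S → trans (meets B∈S) (sym ∣K∣≡t)))
        (subst (_< length (B₀ ∷ S)) (sym (All.lookup weights D∈R)) large)
    where
    meets : ∀ {B} → B ∈ B₀ ∷ S → ∣ D ∩ B ∣ ≡ t
    meets B∈S = AllPairs-lookup (λ {D} {E} ∣D∩E∣≡t → trans (cong ∣_∣ (∩-comm E D)) ∣D∩E∣≡t)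
      pairs D∈R (Sublist.lookup S⊆R B∈S)
      (λ D≡B → differ (trans (cong (restrict A) D≡B) (All.lookup same-restriction B∈S)))

small-family-size : ℕ → ℕ
small-family-size t = suc (2 ^ (t + t) * (t + t))

uniform-intersecting-bound : ∀ t (F : List (Subset n)) →
  All (λ D → ∣ D ∣ ≡ t + t) F → AllPairs (λ D E → ∣ D ∩ E ∣ ≡ t) F →
  t * length F ≤ n + t * small-family-size t
uniform-intersecting-bound t [] _ _ = ≤-trans (≤-reflexive (*-zeroʳ t)) z≤n
uniform-intersecting-bound {n} t (A ∷ R) (∣A∣≡2t ∷ weights) (A-meets ∷ pairs)
  with pigeonhole (restrict A) R
... | v , S , S⊆R , same-restriction , ∣R∣≤2^∣A∣∣S∣ with length S ≤? t + t
...   | yes small = ≤-trans (*-monoʳ-≤ t (s≤s ∣R∣≤)) (m≤n+m _ n)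
  where
  ∣R∣≤ : length R ≤ 2 ^ (t + t) * (t + t)
  ∣R∣≤ = ≤-trans ∣R∣≤2^∣A∣∣S∣ (*-mono-≤ (≤-reflexive (cong (2 ^_) ∣A∣≡2t)) small)
...   | no large
  with large-trace-class⇒kernel t A R S weights A-meets pairs S⊆R same-restriction (≰⇒> large)
...     | K , ∣K∣≡t , kernel =
  ≤-trans (sunflower-bound t K (A ∷ R) kernel
            (All.map (λ ∣D∣≡2t → trans ∣D∣≡2t (cong (_+ t) (sym ∣K∣≡t))) (∣A∣≡2t ∷ weights))
            (AllPairs.map (λ ∣D∩E∣≡t → trans ∣D∩E∣≡t (sym ∣K∣≡t)) (A-meets ∷ pairs)))
          (m≤m+n n _)

-- Codes with distances 2s+1 and 2s+2

distances : ℕ → List ℕ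
distances s = suc (2 * s) ∷ 2 + 2 * s ∷ []

2+2s≡t+t : ∀ s → 2 + 2 * s ≡ suc s + suc s
2+2s≡t+t = solve-∀

∈distances⇒bounds : ∀ s {h} → h ∈ distances s → suc (2 * s) ≤ h × h ≤ 2 + 2 * s
∈distances⇒bounds _ (here refl)         = ≤-refl , n≤1+n _
∈distances⇒bounds _ (there (here refl)) = n≤1+n _ , ≤-refl

pad-bit : ℕ → Subset n → Side
pad-bit s u with ∣ u ∣ ≟ suc (2 * s)
... | yes _ = inside
... | no  _ = outside

pad : ℕ → Subset n → Subset (suc n)
pad s u = pad-bit s u ∷ u

∣pad∣ : ∀ s (u : Subset n) → ∣ u ∣ ∈ distances s → ∣ pad s u ∣ ≡ suc s + suc s
∣pad∣ s u ∣u∣∈ with ∣ u ∣ ≟ suc (2 * s) | ∣u∣∈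
... | yes ∣u∣≡1+2s | _                     = trans (cong suc ∣u∣≡1+2s) (2+2s≡t+t s)
... | no  ∣u∣≢1+2s | here ∣u∣≡1+2s         = contradiction ∣u∣≡1+2s ∣u∣≢1+2s
... | no  _        | there (here ∣u∣≡2+2s) = trans ∣u∣≡2+2s (2+2s≡t+t s)

m+m≤1+n+n⇒m≤n : ∀ {m n} → m + m ≤ suc (n + n) → m ≤ n
m+m≤1+n+n⇒m≤n {m} {n} m+m≤1+n+n = ≮⇒≥ λ n<m →
  <⇒≱ (<-≤-trans (s≤s (≤-reflexive (sym (+-suc n n)))) (+-mono-≤ n<m n<m)) m+m≤1+n+n

intersection-squeeze : ∀ {d i t} → d + (i + i) ≡ (t + t) + (t + t) →
                       t + t ≤ suc d → d ≤ suc (t + t) → i ≡ t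
intersection-squeeze {d} {i} {t} eq lower upper = ≤-antisym i≤t t≤i
  where
  open ≤-Reasoning
  i≤t : i ≤ t
  i≤t = m+m≤1+n+n⇒m≤n (+-cancelˡ-≤ (t + t) _ _ (begin
    (t + t) + (i + i)       ≤⟨ +-monoˡ-≤ (i + i) lower ⟩
    suc d + (i + i)         ≡⟨ cong suc eq ⟩
    suc ((t + t) + (t + t)) ≡⟨ +-suc (t + t) (t + t) ⟨
    (t + t) + suc (t + t)   ∎))
  t≤i : t ≤ i
  t≤i = m+m≤1+n+n⇒m≤n (+-cancelˡ-≤ (t + t) _ _ (begin
    (t + t) + (t + t)       ≡⟨ eq ⟨
    d + (i + i)             ≤⟨ +-monoˡ-≤ (i + i) upper ⟩
    suc ((t + t) + (i + i)) ≡⟨ +-suc (t + t) (i + i) ⟨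
    (t + t) + suc (i + i)   ∎))

∣pad∩pad∣ : ∀ s (u v : Subset n) → ∣ u ∣ ∈ distances s → ∣ v ∣ ∈ distances s →
            hamming u v ∈ distances s → ∣ pad s u ∩ pad s v ∣ ≡ suc s
∣pad∩pad∣ s u v ∣u∣∈ ∣v∣∈ d∈ = intersection-squeeze
  (trans (hamming+2∣p∩q∣≡∣p∣+∣q∣ (pad s u) (pad s v)) (cong₂ _+_ (∣pad∣ s u ∣u∣∈) (∣pad∣ s v ∣v∣∈)))
  (≤-trans (≤-reflexive (sym (2+2s≡t+t s)))
           (s≤s (≤-trans (proj₁ (∈distances⇒bounds s d∈))
                         (hamming≤hamming-∷ (pad-bit s u) (pad-bit s v) u v))))
  (≤-trans (hamming-∷≤suc-hamming (pad-bit s u) (pad-bit s v) u v)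
           (s≤s (≤-trans (proj₂ (∈distances⇒bounds s d∈)) (≤-reflexive (2+2s≡t+t s)))))

code-bound : ∀ s (C : List (Subset n)) → IsCode (distances s) C →
             suc s * length C ≤ suc s + (suc n + suc s * small-family-size (suc s))
code-bound s []      _ = ≤-trans (≤-reflexive (*-zeroʳ (suc s))) z≤n
code-bound {n} s (a ∷ R) (a-dists ∷ pairs) = begin
  t * suc (length R)                    ≡⟨ *-suc t (length R) ⟩
  t + t * length R                      ≡⟨ cong (λ l → t + t * l) (length-map lift R) ⟨
  t + t * length (map lift R)           ≤⟨ +-monoʳ-≤ t (uniform-intersecting-bound t (map lift R)
                                                          weights intersections) ⟩
  t + (suc n + t * small-family-size t)      ∎
  where
  open ≤-Reasoning
  t = suc s
  lift : Subset n → Subset (suc n)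
  lift u = pad s (a ⊕ u)
  ∣a⊕u∣∈ : ∀ {u} → hamming a u ∈ distances s → ∣ a ⊕ u ∣ ∈ distances s
  ∣a⊕u∣∈ {u} = subst (_∈ distances s) (sym (∣p⊕q∣≡hamming a u))
  weights : All (λ D → ∣ D ∣ ≡ t + t) (map lift R)
  weights = Allₚ.map⁺ (All.map (λ {u} d∈ → ∣pad∣ s (a ⊕ u) (∣a⊕u∣∈ d∈)) a-dists)
  intersections : AllPairs (λ D E → ∣ D ∩ E ∣ ≡ t) (map lift R)
  intersections = AllPairsₚ.map⁺ (AllPairs-mapWith-All
    (λ {u} {v} du dv duv → ∣pad∩pad∣ s (a ⊕ u) (a ⊕ v) (∣a⊕u∣∈ du) (∣a⊕u∣∈ dv)
                              (subst (_∈ distances s) (sym (hamming-⊕ˡ a u v)) duv))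
    a-dists pairs)

f-attained : ∀ L n → ∃ λ (C : List (Subset n)) → IsCode L C × f L n ≡ length C
f-attained L n with foldr-selective ⊔-sel 0 (map length (filter (isCode? L) (subsets (allVecs n))))
... | inj₁ f≡0 = [] , [] , f≡0
... | inj₂ f∈  with ∈-map⁻ length f∈
...   | C , C∈ , f≡∣C∣ = C , proj₂ (∈-filter⁻ (isCode? L) {xs = subsets (allVecs n)} C∈) , f≡∣C∣

⊆⇒∈subsets : ∀ {xs ys : List X} → xs ⊆ ys → xs ∈ subsets ys
⊆⇒∈subsets []                           = here refl
⊆⇒∈subsets (y ∷ʳ xs⊆ys)                 = ∈-++⁺ˡ (⊆⇒∈subsets xs⊆ys)
⊆⇒∈subsets {ys = y ∷ ys} (refl ∷ xs⊆ys) =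
  ∈-++⁺ʳ (subsets ys) (∈-map⁺ (y ∷_) (⊆⇒∈subsets xs⊆ys))

∈allVecs : ∀ (v : Subset n) → v ∈ allVecs n
∈allVecs []            = here refl
∈allVecs (outside ∷ v) = ∈-++⁺ˡ (∈-map⁺ (outside ∷_) (∈allVecs v))
∈allVecs (inside  ∷ v) = ∈-++⁺ʳ (map (outside ∷_) (allVecs _)) (∈-map⁺ (inside ∷_) (∈allVecs v))

code-length≤f : ∀ L (C : List (Subset n)) → IsCode L C → C ⊆ allVecs n → length C ≤ f L n
code-length≤f L C code C⊆ = foldr-preservesᵒ (λ x y → [ m≤n⇒m≤n⊔o y , m≤n⇒m≤o⊔n x ]) 0 _
  (inj₂ (Any.map ≤-reflexive (∈-map⁺ length (∈-filter⁺ (isCode? L) (⊆⇒∈subsets C⊆) code))))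

-- Block codes

shift-⊆ : ∀ r {xs : List (Subset k)} → xs ⊆ allVecs k → map (⊥ {r} ++_) xs ⊆ allVecs (r + k)
shift-outside-⊆ : ∀ r {xs : List (Subset k)} → xs ⊆ allVecs k →
                  map (⊥ {suc r} ++_) xs ⊆ map (outside ∷_) (allVecs (r + k))
shift-⊆ zero    {xs} xs⊆ = subst (_⊆ _) (sym (map-id xs)) xs⊆
shift-⊆ (suc r)      xs⊆ = ++⁺ʳ _ (shift-outside-⊆ r xs⊆)
shift-outside-⊆ r {xs} xs⊆ = subst (_⊆ _) (sym (map-∘ xs)) (map⁺ (outside ∷_) (shift-⊆ r xs⊆))

blocks : ∀ t m → List (Subset (m * t))
blocks t zero    = []
blocks t (suc m) = map (⊥ {t} ++_) (blocks t m) ++ᴸ (⊤ {t} ++ ⊥) ∷ []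

length-blocks : ∀ t m → length (blocks t m) ≡ m
length-blocks t zero    = refl
length-blocks t (suc m) = trans (length-++ (map (⊥ {t} ++_) (blocks t m)))
  (trans (cong (_+ 1) (trans (length-map _ (blocks t m)) (length-blocks t m))) (+-comm m 1))

∣blocks∣ : ∀ t m → All (λ v → ∣ v ∣ ≡ t) (blocks t m)
∣blocks∣ t zero    = []
∣blocks∣ t (suc m) = Allₚ.++⁺ (Allₚ.map⁺ (All.map ∣⊥++v∣≡t (∣blocks∣ t m))) (∣⊤++⊥∣≡t ∷ [])
  where
  ∣⊥++v∣≡t : ∀ {v : Subset (m * t)} → ∣ v ∣ ≡ t → ∣ ⊥ {t} ++ v ∣ ≡ t
  ∣⊥++v∣≡t {v} ∣v∣≡t = trans (∣p++q∣≡∣p∣+∣q∣ (⊥ {t}) v) (cong₂ _+_ (∣⊥∣≡0 t) ∣v∣≡t)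
  ∣⊤++⊥∣≡t : ∣ ⊤ {t} ++ ⊥ {m * t} ∣ ≡ t
  ∣⊤++⊥∣≡t = trans (∣p++q∣≡∣p∣+∣q∣ (⊤ {t}) (⊥ {m * t}))
    (trans (cong₂ _+_ (∣⊤∣≡n t) (∣⊥∣≡0 (m * t))) (+-identityʳ t))

hamming-blocks : ∀ t m → AllPairs (λ u v → hamming u v ≡ t + t) (blocks t m)
hamming-blocks t zero    = []
hamming-blocks t (suc m) = AllPairsₚ.++⁺
  (AllPairsₚ.map⁺ (AllPairs.map (λ {u} {v} d≡2t → trans (hamming-⊥++ t u v) d≡2t)
                                (hamming-blocks t m)))
  ([] ∷ [])
  (Allₚ.map⁺ (All.map (λ {u} ∣u∣≡t → far-from-last u ∣u∣≡t ∷ []) (∣blocks∣ t m)))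
  where
  far-from-last : ∀ u → ∣ u ∣ ≡ t → hamming (⊥ {t} ++ u) (⊤ {t} ++ ⊥) ≡ t + t
  far-from-last u ∣u∣≡t = trans (hamming-++ (⊥ {t}) ⊤ u ⊥)
    (cong₂ _+_ (trans (hamming-⊥ˡ (⊤ {t})) (∣⊤∣≡n t)) (trans (hamming-⊥ʳ u) ∣u∣≡t))

blocks-⊆ : ∀ s m → blocks (suc s) m ⊆ allVecs (m * suc s)
blocks-⊆ s zero    = []⊆-universal _
blocks-⊆ s (suc m) = ++⁺ (shift-outside-⊆ s (blocks-⊆ s m))
                         (from∈ (∈-map⁺ (inside ∷_) (∈allVecs (⊤ {s} ++ ⊥ {m * suc s}))))

blocks-≤f : ∀ s r m → m ≤ f (distances s) (r + m * suc s)
blocks-≤f s r m = subst (_≤ f (distances s) (r + m * suc s)) ∣code∣≡m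
  (code-length≤f (distances s) code
    (AllPairsₚ.map⁺ (AllPairs.map (λ {u} {v} d≡2t → there (here (d≡2+2s u v d≡2t)))
                                  (hamming-blocks (suc s) m)))
    (shift-⊆ r (blocks-⊆ s m)))
  where
  code = map (⊥ {r} ++_) (blocks (suc s) m)
  ∣code∣≡m : length code ≡ m
  ∣code∣≡m = trans (length-map _ (blocks (suc s) m)) (length-blocks (suc s) m)
  d≡2+2s : ∀ u v → hamming u v ≡ suc s + suc s → hamming (⊥ {r} ++ u) (⊥ ++ v) ≡ 2 + 2 * s
  d≡2+2s u v d≡2t = trans (hamming-⊥++ r u v) (trans d≡2t (sym (2+2s≡t+t s)))

-- The asymptotics

∣m-n∣≤o : ∀ {m n o} → m ≤ n + o → n ≤ m + o → ∣ m - n ∣ ≤ o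
∣m-n∣≤o {m} {n} m≤n+o n≤m+o with ∣m-n∣≡[m∸n]∨[n∸m] m n
... | inj₁ ∣m-n∣≡m∸n = subst (_≤ _) (sym ∣m-n∣≡m∸n) (m≤n+o⇒m∸n≤o m n m≤n+o)
... | inj₂ ∣m-n∣≡n∸m = subst (_≤ _) (sym ∣m-n∣≡n∸m) (m≤n+o⇒m∸n≤o n m n≤m+o)

excess : ℕ → ℕ
excess s = suc s + suc (suc s * small-family-size (suc s))

f-upper : ∀ s n → f (distances s) n * suc s ≤ n + excess s
f-upper s n with f-attained (distances s) n
... | C , code , f≡∣C∣ = begin
  f (distances s) n * t ≡⟨ cong (_* t) f≡∣C∣ ⟩
  length C * t          ≡⟨ *-comm (length C) t ⟩
  t * length C          ≤⟨ code-bound s C code ⟩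
  t + (suc n + c)       ≡⟨ rearrange t n c ⟩
  n + excess s          ∎
  where
  open ≤-Reasoning
  t = suc s
  c = t * small-family-size t
  rearrange : ∀ t n c → t + (suc n + c) ≡ n + (t + suc c)
  rearrange = solve-∀

f-lower : ∀ s n → n ≤ f (distances s) n * suc s + suc s
f-lower s n = begin
  n                         ≡⟨ n≡r+q*t ⟩
  n % t + (n / t) * t       ≤⟨ +-mono-≤ (m%n≤n n t) (*-monoˡ-≤ t q≤f) ⟩
  t + f (distances s) n * t ≡⟨ +-comm t _ ⟩
  f (distances s) n * t + t ∎
  where
  open ≤-Reasoning
  t = suc s
  n≡r+q*t = m≡m%n+[m/n]*n n t
  q≤f : n / t ≤ f (distances s) n
  q≤f = subst (λ m → n / t ≤ f (distances s) m) (sym n≡r+q*t) (blocks-≤f s (n % t) (n / t))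

theorem6 : (s : ℕ) → (k : ℕ) → ∃ λ N → (n : ℕ) → N ≤ n →
    suc k * ∣ f (suc (2 * s) ∷ 2 + 2 * s ∷ []) n * suc s - n ∣ ≤ n
theorem6 s k = suc k * excess s , λ n k·excess≤n →
  ≤-trans (*-monoʳ-≤ (suc k) (∣m-n∣≤o (f-upper s n) (≤-trans (f-lower s n) excess-covers-t)))
          k·excess≤n
  where
  excess-covers-t : ∀ {a} → a + suc s ≤ a + excess s
  excess-covers-t {a} = +-monoʳ-≤ a (m≤m+n (suc s) _)
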